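{- For every integer $k\ge3$, $\mathrm{Pol}(\mathbf K_k,\mathbf K_{2k-1})$ does not contain an Olšák function.
   Context: $\mathbf K_n$ has domain $\{0,\dots,n-1\}$ and the binary relation $\ne$. $\mathrm{Pol}(\mathbf K_k,\mathbf K_c)$ is the set of all maps $f\colon\{0,\dots,k-1\}^n\to\{0,\dots,c-1\}$ ($n\ge1$) such that $f(a_1,\dots,a_n)\ne f(b_1,\dots,b_n)$ whenever $a_i\ne b_i$ for all $i$. An Olšák function is a $6$-ary function $o$ with $o(x,x,y,y,y,x)=o(x,y,x,y,x,y)=o(y,x,x,x,y,y)$ for all $x,y$. -}

module Defs where

open import Data.Nat using (ℕ; suc)
open import Data.Fin using (Fin; zero; suc)
open import Data.Product using (Σ; _×_)
open import Relation.Binary.PropositionalEquality using (_≡_; _≢_)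

Op : ℕ → ℕ → ℕ → Set
Op n k c = (Fin n → Fin k) → Fin c

IsPol : (k c n : ℕ) → Op n k c → Set
IsPol k c n f = (a b : Fin n → Fin k) → (∀ i → a i ≢ b i) → f a ≢ f b

tuple6 : {A : Set} → A → A → A → A → A → A → Fin 6 → A
tuple6 a₁ a₂ a₃ a₄ a₅ a₆ zero = a₁
tuple6 a₁ a₂ a₃ a₄ a₅ a₆ (suc zero) = a₂
tuple6 a₁ a₂ a₃ a₄ a₅ a₆ (suc (suc zero)) = a₃
tuple6 a₁ a₂ a₃ a₄ a₅ a₆ (suc (suc (suc zero))) = a₄
tuple6 a₁ a₂ a₃ a₄ a₅ a₆ (suc (suc (suc (suc zero)))) = a₅
tuple6 a₁ a₂ a₃ a₄ a₅ a₆ (suc (suc (suc (suc (suc zero))))) = a₆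

IsOlsak : (k c : ℕ) → Op 6 k c → Set
IsOlsak k c o = (x y : Fin k) →
  (o (tuple6 x x y y y x) ≡ o (tuple6 x y x y x y)) ×
  (o (tuple6 x y x y x y) ≡ o (tuple6 y x x x y y))

PolHasOlsak : ℕ → ℕ → Set
PolHasOlsak k c = Σ (Op 6 k c) λ o → IsPol k c 6 o × IsOlsak k c o

-- Let r be an injective self-map of {0,…,k-1} with no fixed points and no
-- 2-cycles (for k ≥ 3 the cyclic successor i ↦ i+1 mod k is one).  Given an
-- Olšák polymorphism o ∈ Pol(K_k, K_c), consider the two colourings
--   G x = o(rx, rx, x, x, x, rx)        S y = o(y, ry, r²y, r²y, y, ry).
-- Each is injective, because o separates coordinatewise-distinct tuples,
-- and no G x equals an S y: rewriting G x with the Olšák identities as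
-- o(rx, x, rx, x, rx, x) or o(x, rx, rx, rx, x, x), one of the three forms of
-- G x differs from S y in every coordinate (split on x = y, x = ry, neither).
-- So G and S together inject 2k points into c colours, i.e. 2k ≤ c, which
-- fails for c = 2k - 1.

module Submission where

open import Defs
open import Data.Nat using (ℕ; _≤_; _+_; _∸_)
open import Relation.Nullary using (¬_)

open import Data.Nat using (zero; suc; s≤s)
open import Data.Nat.Properties using (1+n≰n; 1+n≢n; m≢1+n+m)
open import Data.Fin using (Fin; zero; suc; toℕ; splitAt; join; _≟_)
open import Data.Fin.Properties
  using (injective⇒≤; toℕ-injective; join-splitAt; toℕ-fromℕ; toℕ-inject₁)
open import Data.Fin.Relation.Unary.Top using (view; ‵fromℕ; ‵inject₁)
open import Data.Sum using (_⊎_; inj₁; inj₂; [_,_])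
open import Data.Product using (_,_; _×_; proj₁; proj₂)
open import Data.Empty using (⊥-elim)
open import Function using (_∘_)
open import Function.Definitions using (Injective)
open import Relation.Nullary using (yes; no)
open import Relation.Binary.PropositionalEquality
  using (_≡_; _≢_; refl; sym; trans; cong; module ≡-Reasoning)

disjoint-injections⇒≤ : ∀ {k c} (G S : Fin k → Fin c) →
  Injective _≡_ _≡_ G → Injective _≡_ _≡_ S → (∀ x y → G x ≢ S y) → k + k ≤ c
disjoint-injections⇒≤ {k} {c} G S G-inj S-inj disjoint =
  injective⇒≤ {f = GS ∘ splitAt k} combined-injective
  where
  GS : Fin k ⊎ Fin k → Fin c
  GS = [ G , S ]

  sum-injective : ∀ p q → GS p ≡ GS q → p ≡ q
  sum-injective (inj₁ x) (inj₁ x′) e = cong inj₁ (G-inj e)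
  sum-injective (inj₁ x) (inj₂ y)  e = ⊥-elim (disjoint x y e)
  sum-injective (inj₂ y) (inj₁ x)  e = ⊥-elim (disjoint x y (sym e))
  sum-injective (inj₂ y) (inj₂ y′) e = cong inj₂ (S-inj e)

  combined-injective : Injective _≡_ _≡_ (GS ∘ splitAt k)
  combined-injective {i} {j} e = begin
    i                      ≡⟨ sym (join-splitAt k k i) ⟩
    join k k (splitAt k i) ≡⟨ cong (join k k) (sum-injective (splitAt k i) (splitAt k j) e) ⟩
    join k k (splitAt k j) ≡⟨ join-splitAt k k j ⟩
    j                      ∎
    where open ≡-Reasoning

-- The cyclic successor on {0,…,n}, described on ℕ: u is the successor of t
-- modulo n + 1 (assuming t ≤ n), either by wrapping the top element n to 0 or
-- by stepping t ↦ t + 1.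
CyclicSucc : ℕ → ℕ → ℕ → Set
CyclicSucc n t u = (t ≡ n × u ≡ 0) ⊎ u ≡ suc t

cyclicSucc-injective : ∀ {n t t′ u u′} →
  CyclicSucc n t u → CyclicSucc n t′ u′ → u ≡ u′ → t ≡ t′
cyclicSucc-injective (inj₁ (refl , _)) (inj₁ (refl , _)) _    = refl
cyclicSucc-injective (inj₁ (_ , refl)) (inj₂ refl)       ()
cyclicSucc-injective (inj₂ refl)       (inj₁ (_ , refl)) ()
cyclicSucc-injective (inj₂ refl)       (inj₂ refl)       refl = refl

cyclicSucc-no-fix : ∀ {n t u} → CyclicSucc (suc n) t u → u ≢ t
cyclicSucc-no-fix (inj₁ (refl , refl)) ()
cyclicSucc-no-fix (inj₂ refl)          = 1+n≢n

cyclicSucc-no-2cycle : ∀ {n t u w} →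
  CyclicSucc (suc (suc n)) t u → CyclicSucc (suc (suc n)) u w → w ≢ t
cyclicSucc-no-2cycle (inj₁ (_ , refl))    (inj₁ (() , _))
cyclicSucc-no-2cycle (inj₁ (refl , refl)) (inj₂ refl)       = λ ()
cyclicSucc-no-2cycle (inj₂ refl)          (inj₁ (refl , refl)) = λ ()
cyclicSucc-no-2cycle {t = t} (inj₂ refl)  (inj₂ refl)       = m≢1+n+m t ∘ sym

next : ∀ {n} → Fin (suc n) → Fin (suc n)
next i with view i
... | ‵fromℕ     = zero
... | ‵inject₁ j = suc j

next-spec : ∀ {n} (i : Fin (suc n)) → CyclicSucc n (toℕ i) (toℕ (next i))
next-spec {n} i with view i
... | ‵fromℕ     = inj₁ (toℕ-fromℕ n , refl)
... | ‵inject₁ j = inj₂ (cong suc (sym (toℕ-inject₁ j)))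

-- An injective self-map of Fin k without cycles of length 1 or 2; this is
-- all the proof of the bound needs from the cyclic successor.
record ShortCycleFree (k : ℕ) : Set where
  field
    r           : Fin k → Fin k
    r-injective : Injective _≡_ _≡_ r
    r-no-fix    : ∀ x → r x ≢ x
    r-no-2cycle : ∀ x → r (r x) ≢ x

cyclicShift : ∀ m → ShortCycleFree (suc (suc (suc m)))
cyclicShift m = record
  { r           = next
  ; r-injective = λ {i} {j} e →
      toℕ-injective (cyclicSucc-injective (next-spec i) (next-spec j) (cong toℕ e))
  ; r-no-fix    = λ i → cyclicSucc-no-fix (next-spec i) ∘ cong toℕ
  ; r-no-2cycle = λ i →
      cyclicSucc-no-2cycle (next-spec i) (next-spec (next i)) ∘ cong toℕ
  }

separate : ∀ {k c} {o : Op 6 k c} → IsPol k c 6 o →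
  ∀ {a₁ a₂ a₃ a₄ a₅ a₆ b₁ b₂ b₃ b₄ b₅ b₆ : Fin k} →
  a₁ ≢ b₁ → a₂ ≢ b₂ → a₃ ≢ b₃ → a₄ ≢ b₄ → a₅ ≢ b₅ → a₆ ≢ b₆ →
  o (tuple6 a₁ a₂ a₃ a₄ a₅ a₆) ≢ o (tuple6 b₁ b₂ b₃ b₄ b₅ b₆)
separate pol {a₁} {a₂} {a₃} {a₄} {a₅} {a₆} {b₁} {b₂} {b₃} {b₄} {b₅} {b₆}
  d₁ d₂ d₃ d₄ d₅ d₆ = pol (tuple6 a₁ a₂ a₃ a₄ a₅ a₆) (tuple6 b₁ b₂ b₃ b₄ b₅ b₆) λ
  { zero                               → d₁
  ; (suc zero)                         → d₂
  ; (suc (suc zero))                   → d₃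
  ; (suc (suc (suc zero)))             → d₄
  ; (suc (suc (suc (suc zero))))       → d₅
  ; (suc (suc (suc (suc (suc zero))))) → d₆
  }

module _ {k c : ℕ} (σ : ShortCycleFree k) {o : Op 6 k c}
         (pol : IsPol k c 6 o) (olsak : IsOlsak k c o) where
  open ShortCycleFree σ

  G : Fin k → Fin c
  G x = o (tuple6 (r x) (r x) x x x (r x))

  S : Fin k → Fin c
  S y = o (tuple6 y (r y) (r (r y)) (r (r y)) y (r y))

  r-preserves-≢ : ∀ {x y} → x ≢ y → r x ≢ r y
  r-preserves-≢ x≢y = x≢y ∘ r-injective

  G-injective : Injective _≡_ _≡_ G
  G-injective {x} {x′} e with x ≟ x′
  ... | yes x≡x′ = x≡x′
  ... | no  x≢x′ = ⊥-elim (separate pol rx≢rx′ rx≢rx′ x≢x′ x≢x′ x≢x′ rx≢rx′ e)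
    where
    rx≢rx′ : r x ≢ r x′
    rx≢rx′ = r-preserves-≢ x≢x′

  S-injective : Injective _≡_ _≡_ S
  S-injective {y} {y′} e with y ≟ y′
  ... | yes y≡y′ = y≡y′
  ... | no  y≢y′ =
    ⊥-elim (separate pol y≢y′ ry≢ry′ rry≢rry′ rry≢rry′ y≢y′ ry≢ry′ e)
    where
    ry≢ry′ : r y ≢ r y′
    ry≢ry′ = r-preserves-≢ y≢y′
    rry≢rry′ : r (r y) ≢ r (r y′)
    rry≢rry′ = r-preserves-≢ ry≢ry′

  -- By the Olšák identities with (x , y) := (r x , x), G x has two further forms.
  G-form₂ : ∀ x → G x ≡ o (tuple6 (r x) x (r x) x (r x) x)
  G-form₂ x = proj₁ (olsak (r x) x)

  G-form₃ : ∀ x → G x ≡ o (tuple6 x (r x) (r x) (r x) x x)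
  G-form₃ x = trans (G-form₂ x) (proj₂ (olsak (r x) x))

  -- One of the three forms of G x differs from S y in every coordinate.
  G≢S : ∀ x y → G x ≢ S y
  G≢S x y e with x ≟ y | x ≟ r y
  ... | yes refl | _ =
    separate pol (r-no-fix x) (r-no-fix x ∘ sym) (r-no-fix x ∘ sym ∘ r-injective)
      (r-no-2cycle x ∘ sym) (r-no-fix x) (r-no-fix x ∘ sym)
      (trans (sym (G-form₂ x)) e)
  ... | no _ | yes refl =
    separate pol (r-no-2cycle y) (r-no-fix (r y)) (r-no-fix (r y) ∘ sym)
      (r-no-fix (r y) ∘ sym) (r-no-fix y) (r-no-fix (r y)) e
  ... | no x≢y | no x≢ry =
    separate pol x≢y (r-preserves-≢ x≢y) (r-preserves-≢ x≢ry) (r-preserves-≢ x≢ry)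
      x≢y x≢ry (trans (sym (G-form₃ x)) e)

  olsak-bound : k + k ≤ c
  olsak-bound = disjoint-injections⇒≤ G S G-injective S-injective G≢S

lemma6p4 : (k : ℕ) → 3 ≤ k → ¬ PolHasOlsak k ((k + k) ∸ 1)
lemma6p4 (suc zero)          (s≤s ())
lemma6p4 (suc (suc zero))    (s≤s (s≤s ()))
lemma6p4 (suc (suc (suc m))) _ (o , pol , olsak) =
  1+n≰n (olsak-bound (cyclicShift m) pol olsak)
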